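{- If $(L,B)$ is a strongly regular locale, then $L$ has a strongly regular basis $B'$. Moreover, every basis $B''$ of $L$ with $B'\subseteq B''$ is a strongly regular basis.
   Context: Framework: constructive set theory CZF + RRS-$\bigcup$REA (intuitionistic logic, no Powerset, Restricted Separation only). A locale $(L,B)$ is a pair of classes $(L,\le)$ with finite meets, joins of all subsets, $x\wedge\bigvee U=\bigvee_{y\in U}(x\wedge y)$, and a set $B\subseteq L$ (basis) such that for every $x\in L$, $\{b\in B:b\le x\}$ is a set with join $x$. $y^*=\bigvee\{c\in B:c\wedge y=0\}$; $y\prec x$ iff $1=x\vee y^*$. A relation $R$ is interpolative if $R(x,y)$ implies $R(x,z)$ and $R(z,y)$ for some $z$. $\prec_0$ is the class union of all interpolative set-relations contained in $\prec$ on $L$. $L$ is strongly regular if there is a family $si:B\to\mathcal P(B)$ of subsets of $B$ with $a=\bigvee si(a)$ for all $a\in B$ and $b\prec_0 a$ whenever $b\in si(a)$. A basis $B'$ of $L$ is a strongly regular basis if, with $\prec_0'$ the largest interpolative relation contained in $\prec\cap(B'\times B')$, every $a\in B'$ satisfies $a=\bigvee\{b\in B':b\prec_0'a\}$. -}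

module Defs where

open import Level using (Level; _⊔_; Lift; lift) renaming (suc to lsuc)
open import Data.Product using (Σ; Σ-syntax; _×_; _,_; proj₁; proj₂)
open import Data.Bool using (Bool; true; false)
open import Data.Empty using (⊥)
open import Function using (_∘_)

-- Universe convention: "sets" of CZF are types in Set ℓ; the carrier L of a
-- locale is a class (type in Set c, arbitrary level).  The order is small
-- (valued in Set ℓ), so {b ∈ B : b ≤ x} is a set.

record Locale (c ℓ : Level) : Set (lsuc (c ⊔ ℓ)) where
  infix 4 _≤_
  infixr 7 _∧_
  field
    L       : Set c
    _≤_     : L → L → Set ℓ
    ≤-refl  : ∀ {x} → x ≤ x
    ≤-trans : ∀ {x y z} → x ≤ y → y ≤ z → x ≤ z
    ⊤       : L
    ⊤-max   : ∀ {x} → x ≤ ⊤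
    _∧_     : L → L → L
    ∧-lb₁   : ∀ {x y} → x ∧ y ≤ x
    ∧-lb₂   : ∀ {x y} → x ∧ y ≤ y
    ∧-glb   : ∀ {x y z} → z ≤ x → z ≤ y → z ≤ x ∧ y
    ⋁       : {I : Set ℓ} → (I → L) → L
    ⋁-ub    : ∀ {I : Set ℓ} (f : I → L) (i : I) → f i ≤ ⋁ f
    ⋁-least : ∀ {I : Set ℓ} (f : I → L) {z} → (∀ i → f i ≤ z) → ⋁ f ≤ z
    distrib₁ : ∀ x {I : Set ℓ} (f : I → L) → x ∧ ⋁ f ≤ ⋁ (λ i → x ∧ f i)
    distrib₂ : ∀ x {I : Set ℓ} (f : I → L) → ⋁ (λ i → x ∧ f i) ≤ x ∧ ⋁ f

  infix 4 _≈_
  _≈_ : L → L → Set ℓ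
  x ≈ y = (x ≤ y) × (y ≤ x)

  𝟘 : L
  𝟘 = ⋁ {Lift ℓ ⊥} (λ ())

  infixr 6 _∨_
  _∨_ : L → L → L
  x ∨ y = ⋁ {Lift ℓ Bool} (λ { (lift true) → x ; (lift false) → y })

  IsBasis : (B : Set ℓ) → (B → L) → Set (c ⊔ ℓ)
  IsBasis B β = ∀ x → x ≈ ⋁ {Σ[ b ∈ B ] (β b ≤ x)} (β ∘ proj₁)

  IsJoinOf : ∀ {k} {B : Set ℓ} → (B → L) → (B → Set k) → L → Set (c ⊔ ℓ ⊔ k)
  IsJoinOf {B = B} β P x =
    (∀ b → P b → β b ≤ x) × (∀ z → (∀ b → P b → β b ≤ z) → x ≤ z)

record LocaleWithBasis (c ℓ : Level) : Set (lsuc (c ⊔ ℓ)) where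
  field
    locale  : Locale c ℓ
  open Locale locale public
  field
    B       : Set ℓ
    β       : B → L
    isBasis : IsBasis B β

  _* : L → L
  y * = ⋁ {Σ[ c ∈ B ] (β c ∧ y ≈ 𝟘)} (β ∘ proj₁)

  infix 4 _≺_
  _≺_ : L → L → Set ℓ
  y ≺ x = ⊤ ≈ (x ∨ (y *))

  -- set-relations on the class L: a set of pairs
  record SetRel : Set (c ⊔ lsuc ℓ) where
    field
      Idx : Set ℓ
      lhs : Idx → L
      rhs : Idx → L

  _∋_,_ : SetRel → L → L → Set ℓ
  R ∋ x , y = Σ[ i ∈ SetRel.Idx R ] ((SetRel.lhs R i ≈ x) × (SetRel.rhs R i ≈ y))

  Interpolative : SetRel → Set (c ⊔ ℓ)
  Interpolative R = ∀ x y → R ∋ x , y → Σ[ z ∈ L ] ((R ∋ x , z) × (R ∋ z , y))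

  infix 4 _≺₀_
  _≺₀_ : L → L → Set (c ⊔ lsuc ℓ)
  x ≺₀ y = Σ[ R ∈ SetRel ]
             (Interpolative R × (∀ u v → R ∋ u , v → u ≺ v) × (R ∋ x , y))

  StronglyRegular : Set (c ⊔ lsuc ℓ)
  StronglyRegular =
    Σ[ si ∈ (B → (B → Set ℓ)) ]
      ((∀ a → β a ≈ ⋁ {Σ[ b ∈ B ] si a b} (β ∘ proj₁))
       × (∀ a b → si a b → β b ≺₀ β a))

  InterpolativeOn : (B' : Set ℓ) → (B' → B' → Set ℓ) → Set ℓ
  InterpolativeOn B' R = ∀ x y → R x y → Σ[ z ∈ B' ] (R x z × R z y)

  ≺₀' : (B' : Set ℓ) → (B' → L) → B' → B' → Set (lsuc ℓ)
  ≺₀' B' β' b a = Σ[ R ∈ (B' → B' → Set ℓ) ]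
                   (InterpolativeOn B' R × (∀ u v → R u v → β' u ≺ β' v) × R b a)

  StronglyRegularBasis : (B' : Set ℓ) → (B' → L) → Set (c ⊔ lsuc ℓ)
  StronglyRegularBasis B' β' =
    IsBasis B' β' × (∀ a → IsJoinOf β' (λ b → ≺₀' B' β' b a) (β' a))

  _⊆_ : ∀ {B' B'' : Set ℓ} → (B' → L) → (B'' → L) → Set ℓ
  _⊆_ {B'} {B''} β' β'' = ∀ b' → Σ[ b'' ∈ B'' ] (β'' b'' ≈ β' b')

-- Every interpolative set-relation R ⊆ ≺ witnessing b ≺₀ a can be transported into any
-- basis B'' that contains the right-hand sides of R: relate u, v ∈ B'' when β'' u is a
-- left-hand side of R whose partner lies below β'' v.  This relation is again
-- interpolative (the interpolant is a right-hand side, hence in B'') and contained in ≺,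
-- so b ≺₀' a holds in B''.  Take B' to be B together with the right-hand sides of all
-- the relations witnessing si.  In any basis B'' ⊇ B', an element β'' a is the join of
-- the β e with e ∈ si d and β d ≤ β'' a, and each such β e is ≺₀'-below β'' a.
module Submission where

open import Defs
open import Level using (lift)
open import Data.Product using (Σ; Σ-syntax; _×_; _,_; proj₁; proj₂)
open import Data.Sum using (_⊎_; inj₁; inj₂)
open import Data.Bool using (true; false)
open import Function using (_∘_)
open import Relation.Binary.Bundles using (Preorder)

module WellInside {c ℓ} (X : LocaleWithBasis c ℓ) where
  open LocaleWithBasis X

  ≈-refl : ∀ {x} → x ≈ x
  ≈-refl = ≤-refl , ≤-refl

  ≈-sym : ∀ {x y} → x ≈ y → y ≈ x
  ≈-sym (p , q) = q , p

  ≈-trans : ∀ {x y z} → x ≈ y → y ≈ z → x ≈ z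
  ≈-trans (p , q) (r , s) = ≤-trans p r , ≤-trans s q

  ≤-preorder : Preorder c ℓ ℓ
  ≤-preorder = record
    { Carrier    = L
    ; _≈_        = _≈_
    ; _≲_        = _≤_
    ; isPreorder = record
      { isEquivalence = record { refl = ≈-refl ; sym = ≈-sym ; trans = ≈-trans }
      ; reflexive     = proj₁
      ; trans         = ≤-trans
      }
    }

  open import Relation.Binary.Reasoning.Preorder ≤-preorder

  𝟘-least : ∀ {x} → 𝟘 ≤ x
  𝟘-least = ⋁-least _ (λ ())

  ∨-ub₁ : ∀ {x y} → x ≤ x ∨ y
  ∨-ub₁ = ⋁-ub _ (lift true)

  ∨-ub₂ : ∀ {x y} → y ≤ x ∨ y
  ∨-ub₂ = ⋁-ub _ (lift false)

  ∨-least : ∀ {x y z} → x ≤ z → y ≤ z → x ∨ y ≤ z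
  ∨-least p q = ⋁-least _ (λ { (lift true) → p ; (lift false) → q })

  ∧-monoʳ : ∀ {x y y'} → y ≤ y' → x ∧ y ≤ x ∧ y'
  ∧-monoʳ p = ∧-glb ∧-lb₁ (≤-trans ∧-lb₂ p)

  ∧-distribˡ-∨ : ∀ {x y z} → x ∧ (y ∨ z) ≤ (x ∧ y) ∨ (x ∧ z)
  ∧-distribˡ-∨ {x} = ≤-trans (distrib₁ x _)
    (⋁-least _ (λ { (lift true) → ∨-ub₁ ; (lift false) → ∨-ub₂ }))

  ∧-*-disjoint : ∀ {y} → y ∧ y * ≤ 𝟘
  ∧-*-disjoint {y} = ≤-trans (distrib₁ y _)
    (⋁-least _ (λ { (_ , cy≈𝟘) → ≤-trans (∧-glb ∧-lb₂ ∧-lb₁) (proj₁ cy≈𝟘) }))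

  *-antitone : ∀ {y y'} → y' ≤ y → y * ≤ y' *
  *-antitone y'≤y = ⋁-least _ (λ { (b , by≈𝟘) →
    ⋁-ub (β ∘ proj₁) (b , ≤-trans (∧-monoʳ y'≤y) (proj₁ by≈𝟘) , 𝟘-least) })

  ≺-mono : ∀ {x x' y y'} → y ≺ x → x ≤ x' → y' ≤ y → y' ≺ x'
  ≺-mono (⊤≤x∨y* , _) x≤x' y'≤y =
    ≤-trans ⊤≤x∨y* (∨-least (≤-trans x≤x' ∨-ub₁) (≤-trans (*-antitone y'≤y) ∨-ub₂)) , ⊤-max

  ≺⇒≤ : ∀ {x y} → y ≺ x → y ≤ x
  ≺⇒≤ {x} {y} (⊤≤x∨y* , _) = begin
    y                   ≲⟨ ∧-glb ≤-refl (≤-trans ⊤-max ⊤≤x∨y*) ⟩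
    y ∧ (x ∨ y *)       ≲⟨ ∧-distribˡ-∨ ⟩
    (y ∧ x) ∨ (y ∧ y *) ≲⟨ ∨-least ∧-lb₂ (≤-trans ∧-*-disjoint 𝟘-least) ⟩
    x                   ∎

  ≺₀'⇒≤ : ∀ {B'' β'' a b} → ≺₀' B'' β'' b a → β'' b ≤ β'' a
  ≺₀'⇒≤ (_ , _ , R⊆≺ , Rba) = ≺⇒≤ (R⊆≺ _ _ Rba)

  module Restriction (R : SetRel) (interpolative : Interpolative R)
                     (R⊆≺ : ∀ x y → R ∋ x , y → x ≺ y)
                     {B'' : Set ℓ} (β'' : B'' → L) (rhs⊆ : SetRel.rhs R ⊆ β'') where
    open SetRel R

    _R''_ : B'' → B'' → Set ℓ
    u R'' v = Σ[ i ∈ Idx ] ((β'' u ≈ lhs i) × (rhs i ≤ β'' v))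

    R''-interpolative : InterpolativeOn B'' _R''_
    R''-interpolative u v (i , u≈ , ≤v)
      with interpolative _ _ (i , ≈-refl , ≈-refl)
    ... | z , (j , lhsj≈ , rhsj≈z) , (k , lhsk≈z , rhsk≈) =
      w , (j , ≈-trans u≈ (≈-sym lhsj≈) , proj₂ w≈) ,
          (k , ≈-trans w≈ (≈-trans rhsj≈z (≈-sym lhsk≈z)) , ≤-trans (proj₁ rhsk≈) ≤v)
      where
        w = proj₁ (rhs⊆ j)
        w≈ = proj₂ (rhs⊆ j)

    R''⊆≺ : ∀ u v → u R'' v → β'' u ≺ β'' v
    R''⊆≺ u v (i , u≈ , ≤v) = ≺-mono (R⊆≺ _ _ (i , ≈-refl , ≈-refl)) ≤v (proj₁ u≈)

    ≺₀'-restrict : ∀ {u v x y} → R ∋ x , y → β'' u ≈ x → y ≤ β'' v → ≺₀' B'' β'' u v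
    ≺₀'-restrict (i , lhs≈x , rhs≈y) u≈x y≤v =
      _R''_ , R''-interpolative , R''⊆≺ ,
      (i , ≈-trans u≈x (≈-sym lhs≈x) , ≤-trans (proj₁ rhs≈y) y≤v)

  ≺₀⇒≺₀' : ∀ {x y B''} {β'' : B'' → L} {u v} (x≺₀y : x ≺₀ y) → SetRel.rhs (proj₁ x≺₀y) ⊆ β'' →
           β'' u ≈ x → y ≤ β'' v → ≺₀' B'' β'' u v
  ≺₀⇒≺₀' (R , interpolative , R⊆≺ , Rxy) rhs⊆ =
    Restriction.≺₀'-restrict R interpolative R⊆≺ _ rhs⊆ Rxy

module StronglyRegularLocale {c ℓ} (X : LocaleWithBasis c ℓ)
                             (SR : LocaleWithBasis.StronglyRegular X) where
  open LocaleWithBasis X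
  open WellInside X

  si : B → B → Set ℓ
  si = proj₁ SR

  si-join : ∀ a → β a ≈ ⋁ {Σ[ b ∈ B ] si a b} (β ∘ proj₁)
  si-join = proj₁ (proj₂ SR)

  si⇒≺₀ : ∀ a b → si a b → β b ≺₀ β a
  si⇒≺₀ = proj₂ (proj₂ SR)

  ≤-from-si : ∀ {x z} → (∀ a b → β a ≤ x → si a b → β b ≤ z) → x ≤ z
  ≤-from-si {x} H = ≤-trans (proj₁ (isBasis x))
    (⋁-least _ (λ { (a , a≤x) → ≤-trans (proj₁ (si-join a))
      (⋁-least _ (λ { (b , sab) → H a b a≤x sab })) }))

  witness : ∀ {a b} → si a b → SetRel
  witness {a} {b} sab = proj₁ (si⇒≺₀ a b sab)

  Witnessed : Set ℓ
  Witnessed = Σ[ a ∈ B ] Σ[ b ∈ B ] Σ[ sab ∈ si a b ] SetRel.Idx (witness sab)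

  B' : Set ℓ
  B' = B ⊎ Witnessed

  β' : B' → L
  β' (inj₁ b)               = β b
  β' (inj₂ (_ , _ , sab , i)) = SetRel.rhs (witness sab) i

  ⊆-refl : β' ⊆ β'
  ⊆-refl b = b , ≈-refl

  B'-basis : IsBasis B' β'
  B'-basis x = ≤-trans (proj₁ (isBasis x)) (⋁-least _ (λ { (b , b≤x) → ⋁-ub _ (inj₁ b , b≤x) }))
             , ⋁-least _ proj₂

  ⊇B'-stronglyRegular : ∀ {B''} (β'' : B'' → L) → IsBasis B'' β'' → β' ⊆ β'' →
                        StronglyRegularBasis B'' β''
  ⊇B'-stronglyRegular {B''} β'' basis'' B'⊆B'' =
    basis'' , λ a → (λ b → ≺₀'⇒≤) , λ z H → ≤-from-si (below a z H)
    where
      below : ∀ a z → (∀ b → ≺₀' B'' β'' b a → β'' b ≤ z) →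
              ∀ d e → β d ≤ β'' a → si d e → β e ≤ z
      below a z H d e d≤a sde with B'⊆B'' (inj₁ e)
      ... | e'' , e''≈e = ≤-trans (proj₂ e''≈e) (H e'' (≺₀⇒≺₀' (si⇒≺₀ d e sde) rhs⊆B'' e''≈e d≤a))
        where
          rhs⊆B'' : SetRel.rhs (witness sde) ⊆ β''
          rhs⊆B'' i = B'⊆B'' (inj₂ (d , e , sde , i))

proposition3p2 : ∀ {c ℓ} (X : LocaleWithBasis c ℓ) → LocaleWithBasis.StronglyRegular X →
    Σ[ B' ∈ Set ℓ ] Σ[ β' ∈ (B' → LocaleWithBasis.L X) ]
      (LocaleWithBasis.StronglyRegularBasis X B' β'
       × (∀ (B'' : Set ℓ) (β'' : B'' → LocaleWithBasis.L X) →
            LocaleWithBasis.IsBasis X B'' β'' → LocaleWithBasis._⊆_ X β' β'' →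
            LocaleWithBasis.StronglyRegularBasis X B'' β''))
proposition3p2 X SR =
  B' , β' , ⊇B'-stronglyRegular β' B'-basis ⊆-refl ,
  λ _ β'' basis'' B'⊆B'' → ⊇B'-stronglyRegular β'' basis'' B'⊆B''
  where open StronglyRegularLocale X SR
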